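{- If an $\mathsf{S4K}$-logic $\Theta$ is characterised by a class $\mathcal C$ of general $\mathsf{S4K}$-frames, then the $\mathsf{iA}$-logic $\rho\Theta=\{\varphi\in\mathcal L_{\rightsquigarrow}: t(\varphi)\in\Theta\}$ is characterised by the class $\hat\rho\mathcal C=\{\hat\rho\mathfrak F:\mathfrak F\in\mathcal C\}$ of general $\rightsquigarrow$-frames.
   Context: $\mathcal L_{\rightsquigarrow}$: $\varphi::=p\mid\top\mid\bot\mid\varphi\wedge\varphi\mid\varphi\vee\varphi\mid\varphi\to\varphi\mid\varphi\rightsquigarrow\varphi$. $\mathcal L_{i,m}$: classical propositional bimodal formulas with boxes $\Box_i,\Box_m$. An $\mathsf{S4K}$-logic is a set of $\mathcal L_{i,m}$-formulas containing all classical tautologies, the $\mathsf K$ axioms for $\Box_i$ and $\Box_m$, and $\Box_ip\to p$, $\Box_ip\to\Box_i\Box_ip$, closed under modus ponens, necessitation for both boxes and uniform substitution. Translation $t$: $t(p)=\Box_ip$, $t(\top)=\top$, $t(\bot)=\bot$, $t(\varphi\wedge\psi)=\Box_i(t\varphi\wedge t\psi)$, $t(\varphi\vee\psi)=\Box_i(t\varphi\vee t\psi)$, $t(\varphi\to\psi)=\Box_i(t\varphi\to t\psi)$, $t(\varphi\rightsquigarrow\psi)=\Box_i\Box_m(t\varphi\to t\psi)$. A general $\mathsf{S4K}$-frame $(X,R_i,R_m,Q)$: $R_i$ preorder, $R_m$ relation, $Q$ Boolean subalgebra of the powerset closed under $[i]a=\{x:\forall y(xR_iy\Rightarrow y\in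 a)\}$ and $[m]a$ (analogous). Validity: true everywhere under all valuations into $Q$. A general $\rightsquigarrow$-frame $(Y,\preceq,\sqsubset,P)$: $\preceq$ partial order, $x\preceq y\sqsubset z\Rightarrow x\sqsubset z$, $P$ family of upsets containing $Y,\emptyset$ closed under $\cap,\cup$, $a\underline{\to}b=\{x:\forall y(x\preceq y,y\in a\Rightarrow y\in b)\}$, $a\underline{\rightsquigarrow}b=\{x:\forall y(x\sqsubset y,y\in a\Rightarrow y\in b)\}$; validity: true everywhere under all valuations into $P$. A logic is characterised by a class $\mathcal C$ if it equals the set of formulas valid in all members of $\mathcal C$. $\hat\rho(X,R_i,R_m,Q)=([X],[R_i],[R_m^*],\hat\rho Q)$, where $xR_m^*z$ iff $xR_iyR_mz$ for some $y$; $[X]$ the classes of $x\sim y\iff(xR_iy\wedge yR_ix)$; $[x][R_i][y]$ iff $xR_iy$; $[x][R_m^*][y]$ iff $xR_m^*y'$ for some $y'\sim y$; $\hat\rho Q=\{[i]\mathcal A:\mathcal A\subseteq[X],\ \bigcup\mathcal A\in Q\}$ with $[i]$ w.r.t. $[R_i]$. -}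

module Defs where

open import Level using (Level)
open import Data.Nat using (ℕ)
open import Data.Bool using (Bool; true; false; T)
open import Data.Unit using (⊤; tt)
open import Data.Empty using (⊥)
open import Data.Sum using (_⊎_)
open import Data.Product using (Σ; _×_; _,_; ∃-syntax)
open import Relation.Nullary using (¬_)
open import Relation.Binary.PropositionalEquality using (_≡_)

record _⇔_ {a b : Level} (A : Set a) (B : Set b) : Set (a Level.⊔ b) where
  constructor mk⇔
  field
    to   : A → B
    from : B → A

data L⇝ : Set where
  v    : ℕ → L⇝
  top  : L⇝
  bot  : L⇝
  _∧_  : L⇝ → L⇝ → L⇝
  _∨_  : L⇝ → L⇝ → L⇝
  _⟶_  : L⇝ → L⇝ → L⇝
  _⇝_  : L⇝ → L⇝ → L⇝

data Lim : Set where
  mv    : ℕ → Lim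
  mtop  : Lim
  mbot  : Lim
  _m∧_  : Lim → Lim → Lim
  _m∨_  : Lim → Lim → Lim
  _m→_  : Lim → Lim → Lim
  □ᵢ    : Lim → Lim
  □ₘ    : Lim → Lim

subst : (ℕ → Lim) → Lim → Lim
subst σ (mv n)   = σ n
subst σ mtop     = mtop
subst σ mbot     = mbot
subst σ (a m∧ b) = subst σ a m∧ subst σ b
subst σ (a m∨ b) = subst σ a m∨ subst σ b
subst σ (a m→ b) = subst σ a m→ subst σ b
subst σ (□ᵢ a)   = □ᵢ (subst σ a)
subst σ (□ₘ a)   = □ₘ (subst σ a)

BoxFree : Lim → Set
BoxFree (mv n)   = ⊤
BoxFree mtop     = ⊤
BoxFree mbot     = ⊤
BoxFree (a m∧ b) = BoxFree a × BoxFree b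
BoxFree (a m∨ b) = BoxFree a × BoxFree b
BoxFree (a m→ b) = BoxFree a × BoxFree b
BoxFree (□ᵢ a)   = ⊥
BoxFree (□ₘ a)   = ⊥

-- classical two-valued evaluation (boxes never occur in tautologies)
evalB : (ℕ → Bool) → Lim → Bool
evalB w (mv n)   = w n
evalB w mtop     = true
evalB w mbot     = false
evalB w (a m∧ b) with evalB w a
... | true  = evalB w b
... | false = false
evalB w (a m∨ b) with evalB w a
... | true  = true
... | false = evalB w b
evalB w (a m→ b) with evalB w a
... | true  = evalB w b
... | false = true
evalB w (□ᵢ a)   = false
evalB w (□ₘ a)   = false

-- classical propositional tautology (substitution instances are obtained
-- via closure under uniform substitution)
Tautology : Lim → Set
Tautology φ = BoxFree φ × (∀ (w : ℕ → Bool) → T (evalB w φ))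

p₀ q₀ : Lim
p₀ = mv 0
q₀ = mv 1

record IsS4KLogic (Θ : Lim → Set) : Set where
  field
    taut  : ∀ φ → Tautology φ → Θ φ
    Ki    : Θ (□ᵢ (p₀ m→ q₀) m→ (□ᵢ p₀ m→ □ᵢ q₀))
    Km    : Θ (□ₘ (p₀ m→ q₀) m→ (□ₘ p₀ m→ □ₘ q₀))
    Ti    : Θ (□ᵢ p₀ m→ p₀)
    4i    : Θ (□ᵢ p₀ m→ □ᵢ (□ᵢ p₀))
    mp    : ∀ φ ψ → Θ φ → Θ (φ m→ ψ) → Θ ψ
    neci  : ∀ φ → Θ φ → Θ (□ᵢ φ)
    necm  : ∀ φ → Θ φ → Θ (□ₘ φ)
    usub  : ∀ σ φ → Θ φ → Θ (subst σ φ)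

t : L⇝ → Lim
t (v n)   = □ᵢ (mv n)
t top     = mtop
t bot     = mbot
t (a ∧ b) = □ᵢ (t a m∧ t b)
t (a ∨ b) = □ᵢ (t a m∨ t b)
t (a ⟶ b) = □ᵢ (t a m→ t b)
t (a ⇝ b) = □ᵢ (□ₘ (t a m→ t b))

ρ : (Lim → Set) → (L⇝ → Set)
ρ Θ φ = Θ (t φ)

Subset : Set → Set₁
Subset X = X → Set

_≐_ : {X : Set} → Subset X → Subset X → Set
a ≐ b = ∀ x → a x ⇔ b x

box : {X : Set} → (X → X → Set) → Subset X → Subset X
box R a x = ∀ y → R x y → a y

record S4KFrame : Set₂ where
  field
    X  : Set
    Ri : X → X → Set
    Rm : X → X → Set
    Q  : Subset X → Set₁

record IsGeneralS4KFrame (F : S4KFrame) : Set₁ where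
  open S4KFrame F
  field
    Ri-refl  : ∀ x → Ri x x
    Ri-trans : ∀ x y z → Ri x y → Ri y z → Ri x z
    Q-ext    : ∀ a b → a ≐ b → Q a → Q b
    Q-∅      : Q (λ _ → ⊥)
    Q-X      : Q (λ _ → ⊤)
    Q-∩      : ∀ a b → Q a → Q b → Q (λ x → a x × b x)
    Q-∪      : ∀ a b → Q a → Q b → Q (λ x → a x ⊎ b x)
    Q-compl  : ∀ a → Q a → Q (λ x → ¬ a x)
    Q-[i]    : ∀ a → Q a → Q (box Ri a)
    Q-[m]    : ∀ a → Q a → Q (box Rm a)

module _ (F : S4KFrame) where
  open S4KFrame F
  satM : (ℕ → Subset X) → X → Lim → Set
  satM V x (mv n)   = V n x
  satM V x mtop     = ⊤
  satM V x mbot     = ⊥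
  satM V x (a m∧ b) = satM V x a × satM V x b
  satM V x (a m∨ b) = satM V x a ⊎ satM V x b
  satM V x (a m→ b) = satM V x a → satM V x b
  satM V x (□ᵢ a)   = ∀ y → Ri x y → satM V y a
  satM V x (□ₘ a)   = ∀ y → Rm x y → satM V y a

  ValidS4K : Lim → Set₁
  ValidS4K φ = ∀ (V : ℕ → Subset X) → (∀ n → Q (V n)) → ∀ x → satM V x φ

record ⇝Frame : Set₂ where
  field
    Y   : Set
    _≈_ : Y → Y → Set
    _≼_ : Y → Y → Set
    _⊏_ : Y → Y → Set
    P   : Subset Y → Set₁

record IsGeneral⇝Frame (G : ⇝Frame) : Set₁ where
  open ⇝Frame G
  field
    ≈-refl   : ∀ x → x ≈ x
    ≈-sym    : ∀ x y → x ≈ y → y ≈ x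
    ≈-trans  : ∀ x y z → x ≈ y → y ≈ z → x ≈ z
    ≼-refl   : ∀ x y → x ≈ y → x ≼ y
    ≼-trans  : ∀ x y z → x ≼ y → y ≼ z → x ≼ z
    ≼-antisym : ∀ x y → x ≼ y → y ≼ x → x ≈ y
    ⊏-resp   : ∀ x y z → y ≈ z → x ⊏ y → x ⊏ z
    ≼⊏       : ∀ x y z → x ≼ y → y ⊏ z → x ⊏ z
    P-upset  : ∀ a → P a → ∀ x y → x ≼ y → a x → a y
    P-ext    : ∀ a b → a ≐ b → P a → P b
    P-Y      : P (λ _ → ⊤)
    P-∅      : P (λ _ → ⊥)
    P-∩      : ∀ a b → P a → P b → P (λ x → a x × b x)
    P-∪      : ∀ a b → P a → P b → P (λ x → a x ⊎ b x)
    P-→      : ∀ a b → P a → P b → P (λ x → ∀ y → x ≼ y → a y → b y)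
    P-⇝      : ∀ a b → P a → P b → P (λ x → ∀ y → x ⊏ y → a y → b y)

module _ (G : ⇝Frame) where
  open ⇝Frame G
  sat⇝ : (ℕ → Subset Y) → Y → L⇝ → Set
  sat⇝ V x (v n)   = V n x
  sat⇝ V x top     = ⊤
  sat⇝ V x bot     = ⊥
  sat⇝ V x (a ∧ b) = sat⇝ V x a × sat⇝ V x b
  sat⇝ V x (a ∨ b) = sat⇝ V x a ⊎ sat⇝ V x b
  sat⇝ V x (a ⟶ b) = ∀ y → x ≼ y → sat⇝ V y a → sat⇝ V y b
  sat⇝ V x (a ⇝ b) = ∀ y → x ⊏ y → sat⇝ V y a → sat⇝ V y b

  Valid⇝ : L⇝ → Set₁
  Valid⇝ φ = ∀ (V : ℕ → Subset Y) → (∀ n → P (V n)) → ∀ x → sat⇝ V x φ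

-- The construction ρ̂
-- [X] is represented as the setoid (X, ∼); subsets of [X] are ∼-closed
-- subsets of X, and ⋃𝒜 is the same subset seen on X.

ρ̂ : S4KFrame → ⇝Frame
ρ̂ F = record
  { Y   = X
  ; _≈_ = _∼_
  ; _≼_ = Ri
  ; _⊏_ = λ x y → Σ X (λ y′ → Rm* x y′ × (y′ ∼ y))
  ; P   = λ b → Σ (Subset X) (λ A →
            (∀ x y → x ∼ y → A x → A y) × Q A × (b ≐ box Ri A))
  }
  where
  open S4KFrame F
  _∼_ : X → X → Set
  x ∼ y = Ri x y × Ri y x
  Rm* : X → X → Set
  Rm* x z = Σ X (λ y → Ri x y × Rm y z)

S4KClass : Set₃
S4KClass = S4KFrame → Set₂

⇝Class : Set₃
⇝Class = ⇝Frame → Set₂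

CharacterisedS4K : (Lim → Set) → S4KClass → Set₂
CharacterisedS4K Θ 𝒞 = ∀ φ → Θ φ ⇔ (∀ F → 𝒞 F → ValidS4K F φ)

Characterised⇝ : (L⇝ → Set) → ⇝Class → Set₂
Characterised⇝ Λ 𝒟 = ∀ φ → Λ φ ⇔ (∀ G → 𝒟 G → Valid⇝ G φ)

ρ̂Class : S4KClass → ⇝Class
ρ̂Class 𝒞 G = Σ S4KFrame (λ F → 𝒞 F × (ρ̂ F ≡ G))

LEM : Set₁
LEM = ∀ (A : Set) → A ⊎ ¬ A

{-# OPTIONS --safe #-}
-- The ⇝-frame ρ̂F validates φ exactly when F validates t φ.  Every translated
-- formula starts with □ᵢ (or is ⊤, ⊥), so its truth set is an Rᵢ-upset in Q,
-- and the admissible sets of ρ̂F are precisely such upsets.  A truth lemma then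
-- identifies the truth set of t φ in F with that of φ in ρ̂F: on upsets □ᵢ is
-- the identity, Heyting implication is □ᵢ(a → b), and □ᵢ□ₘ(a → b) quantifies
-- over Rᵢ;Rₘ-successors, which up to Rᵢ-equivalence is the relation ⊏ of ρ̂F.
-- Hence t φ ∈ Θ iff t φ is valid on 𝒞 iff φ is valid on ρ̂𝒞.  Excluded middle
-- is needed only to see that Q, a Boolean algebra, is closed under a → b.
module Submission where

open import Defs
open import Data.Product using (_×_; _,_; proj₁; proj₂)
open import Data.Sum using (_⊎_; inj₁; inj₂)
open import Data.Nat using (ℕ)
open import Data.Empty using (⊥-elim)
open import Function using (id)
open import Relation.Nullary using (¬_)
open import Relation.Binary.PropositionalEquality using (refl)
open _⇔_

⇔-refl : ∀ {A : Set} → A ⇔ A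
⇔-refl = mk⇔ id id

⇔-sym : ∀ {A B : Set} → A ⇔ B → B ⇔ A
⇔-sym e = mk⇔ (from e) (to e)

⇔-trans : ∀ {A B C : Set} → A ⇔ B → B ⇔ C → A ⇔ C
⇔-trans e f = mk⇔ (λ a → to f (to e a)) (λ c → from e (from f c))

×-cong : ∀ {A B C D : Set} → A ⇔ B → C ⇔ D → (A × C) ⇔ (B × D)
×-cong e f = mk⇔ (λ (a , c) → to e a , to f c) (λ (b , d) → from e b , from f d)

⊎-cong : ∀ {A B C D : Set} → A ⇔ B → C ⇔ D → (A ⊎ C) ⇔ (B ⊎ D)
⊎-cong e f = mk⇔ (λ { (inj₁ a) → inj₁ (to e a) ; (inj₂ c) → inj₂ (to f c) })
                 (λ { (inj₁ b) → inj₁ (from e b) ; (inj₂ d) → inj₂ (from f d) })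

→⇔¬⊎ : LEM → ∀ {A B : Set} → (A → B) ⇔ (¬ A ⊎ B)
→⇔¬⊎ lem {A} = mk⇔ classical (λ { (inj₁ ¬a) a → ⊥-elim (¬a a) ; (inj₂ b) _ → b })
  where
  classical : ∀ {B} → (A → B) → ¬ A ⊎ B
  classical f with lem A
  ... | inj₁ a  = inj₂ (f a)
  ... | inj₂ ¬a = inj₁ ¬a

≐-sym : ∀ {X : Set} {a b : Subset X} → a ≐ b → b ≐ a
≐-sym e x = ⇔-sym (e x)

≐-trans : ∀ {X : Set} {a b c : Subset X} → a ≐ b → b ≐ c → a ≐ c
≐-trans e f x = ⇔-trans (e x) (f x)

_⇒[_]_ : {X : Set} → Subset X → (X → X → Set) → Subset X → Subset X
(a ⇒[ R ] b) x = ∀ y → R x y → a y → b y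

⇒-cong : ∀ {X : Set} (R : X → X → Set) {a a′ b b′ : Subset X} →
         a ≐ a′ → b ≐ b′ → (a ⇒[ R ] b) ≐ (a′ ⇒[ R ] b′)
⇒-cong R e f x = mk⇔ (λ h y r a′y → to (f y) (h y r (from (e y) a′y)))
                     (λ h y r ay → from (f y) (h y r (to (e y) ay)))

module _ (F : S4KFrame) (F-general : IsGeneralS4KFrame F) where
  open S4KFrame F
  open IsGeneralS4KFrame F-general
  open ⇝Frame (ρ̂ F) using (P; _⊏_)

  Upset : Subset X → Set
  Upset a = ∀ {x y} → Ri x y → a x → a y

  box-upset : ∀ a → Upset (box Ri a)
  box-upset a {x} {y} r h z r′ = h z (Ri-trans x y z r r′)

  ×-upset : ∀ {a b} → Upset a → Upset b → Upset (λ x → a x × b x)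
  ×-upset ua ub r (ax , bx) = ua r ax , ub r bx

  ⊎-upset : ∀ {a b} → Upset a → Upset b → Upset (λ x → a x ⊎ b x)
  ⊎-upset ua ub r (inj₁ ax) = inj₁ (ua r ax)
  ⊎-upset ua ub r (inj₂ bx) = inj₂ (ub r bx)

  box-upset-≐ : ∀ {a} → Upset a → box Ri a ≐ a
  box-upset-≐ ua x = mk⇔ (λ h → h x (Ri-refl x)) (λ ax y r → ua r ax)

  ⇒⊏-≐-box-box : ∀ {a b} → Upset a → Upset b →
                  (a ⇒[ _⊏_ ] b) ≐ box Ri (box Rm (λ z → a z → b z))
  ⇒⊏-≐-box-box ua ub x = mk⇔
    (λ h w r z m → h z (z , (w , r , m) , Ri-refl z , Ri-refl z))
    (λ { h y (y′ , (w , r , m) , y′Riy , yRiy′) ay → ub y′Riy (h w r y′ m (ua yRiy′ ay)) })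

  Q-⇒ : LEM → ∀ {a b} → Q a → Q b → Q (λ x → a x → b x)
  Q-⇒ lem {a} {b} qa qb =
    Q-ext _ _ (λ x → ⇔-sym (→⇔¬⊎ lem)) (Q-∪ _ b (Q-compl a qa) qb)

  P-resp-≐ : ∀ {a b} → a ≐ b → P a → P b
  P-resp-≐ e (A , A-closed , qA , a≐□A) = A , A-closed , qA , ≐-trans (≐-sym e) a≐□A

  P-upset-Q : ∀ {a} → Upset a → Q a → P a
  P-upset-Q {a} ua qa = a , (λ x y (xRiy , _) → ua xRiy) , qa , ≐-sym (box-upset-≐ ua)

  P-box : ∀ {a} → Q a → P (box Ri a)
  P-box {a} qa = P-upset-Q (box-upset a) (Q-[i] a qa)

  P⇒Upset : ∀ {a} → P a → Upset a
  P⇒Upset (A , _ , _ , a≐□A) {x} {y} r ax = from (a≐□A y) (box-upset A r (to (a≐□A x) ax))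

  P⇒Q : ∀ {a} → P a → Q a
  P⇒Q (A , _ , qA , a≐□A) = Q-ext _ _ (≐-sym a≐□A) (Q-[i] A qA)

  ρ̂-isGeneral⇝Frame : LEM → IsGeneral⇝Frame (ρ̂ F)
  ρ̂-isGeneral⇝Frame lem = record
    { ≈-refl    = λ x → Ri-refl x , Ri-refl x
    ; ≈-sym     = λ x y (xRiy , yRix) → yRix , xRiy
    ; ≈-trans   = λ x y z (xRiy , yRix) (yRiz , zRiy) →
                    Ri-trans x y z xRiy yRiz , Ri-trans z y x zRiy yRix
    ; ≼-refl    = λ x y (xRiy , _) → xRiy
    ; ≼-trans   = Ri-trans
    ; ≼-antisym = λ x y xRiy yRix → xRiy , yRix
    ; ⊏-resp    = λ { x y z (yRiz , zRiy) (y′ , Rm*xy′ , y′Riy , yRiy′) →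
                      y′ , Rm*xy′ , Ri-trans y′ y z y′Riy yRiz , Ri-trans z y y′ zRiy yRiy′ }
    ; ≼⊏        = λ { x y z xRiy (z′ , (w , yRiw , wRmz′) , z′∼z) →
                      z′ , (w , Ri-trans x y w xRiy yRiw , wRmz′) , z′∼z }
    ; P-upset   = λ a pa x y → P⇒Upset pa
    ; P-ext     = λ a b → P-resp-≐
    ; P-Y       = P-upset-Q _ Q-X
    ; P-∅       = P-upset-Q (λ _ ()) Q-∅
    ; P-∩       = λ a b pa pb →
                    P-upset-Q (×-upset (P⇒Upset pa) (P⇒Upset pb)) (Q-∩ a b (P⇒Q pa) (P⇒Q pb))
    ; P-∪       = λ a b pa pb →
                    P-upset-Q (⊎-upset (P⇒Upset pa) (P⇒Upset pb)) (Q-∪ a b (P⇒Q pa) (P⇒Q pb))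
    ; P-→       = λ a b pa pb → P-box (Q-⇒ lem (P⇒Q pa) (P⇒Q pb))
    ; P-⇝       = λ a b pa pb →
                    P-resp-≐ (≐-sym (⇒⊏-≐-box-box (P⇒Upset pa) (P⇒Upset pb)))
                      (P-box (Q-[m] _ (Q-⇒ lem (P⇒Q pa) (P⇒Q pb))))
    }

  module _ (V : ℕ → Subset X) where
    ⟦t_⟧ : L⇝ → Subset X
    ⟦t φ ⟧ x = satM F V x (t φ)

    ⟦t⟧-upset : ∀ φ → Upset ⟦t φ ⟧
    ⟦t⟧-upset (v n)   = box-upset _
    ⟦t⟧-upset top     = _
    ⟦t⟧-upset bot     = λ _ ()
    ⟦t⟧-upset (a ∧ b) = box-upset _
    ⟦t⟧-upset (a ∨ b) = box-upset _
    ⟦t⟧-upset (a ⟶ b) = box-upset _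
    ⟦t⟧-upset (a ⇝ b) = box-upset _

    ⟦t⟧-≐-sat⇝ : (U : ℕ → Subset X) → (∀ n → U n ≐ box Ri (V n)) →
                 ∀ φ → ⟦t φ ⟧ ≐ (λ x → sat⇝ (ρ̂ F) U x φ)
    ⟦t⟧-≐-sat⇝ U U≐□V = go
      where
      go : ∀ φ → ⟦t φ ⟧ ≐ (λ x → sat⇝ (ρ̂ F) U x φ)
      go (v n)   = ≐-sym (U≐□V n)
      go top     = λ _ → ⇔-refl
      go bot     = λ _ → ⇔-refl
      go (a ∧ b) = ≐-trans (box-upset-≐ (×-upset (⟦t⟧-upset a) (⟦t⟧-upset b)))
                           (λ x → ×-cong (go a x) (go b x))
      go (a ∨ b) = ≐-trans (box-upset-≐ (⊎-upset (⟦t⟧-upset a) (⟦t⟧-upset b)))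
                           (λ x → ⊎-cong (go a x) (go b x))
      go (a ⟶ b) = ⇒-cong Ri (go a) (go b)
      go (a ⇝ b) = ≐-trans (≐-sym (⇒⊏-≐-box-box (⟦t⟧-upset a) (⟦t⟧-upset b)))
                           (⇒-cong _⊏_ (go a) (go b))

  ValidS4K-t⇔Valid⇝-ρ̂ : ∀ φ → ValidS4K F (t φ) ⇔ Valid⇝ (ρ̂ F) φ
  ValidS4K-t⇔Valid⇝-ρ̂ φ = mk⇔
    (λ valid U pU x →
      let A = λ n → proj₁ (pU n) in
      to (⟦t⟧-≐-sat⇝ A U (λ n → proj₂ (proj₂ (proj₂ (pU n)))) φ x)
         (valid A (λ n → proj₁ (proj₂ (proj₂ (pU n)))) x))
    (λ valid V qV x →
      from (⟦t⟧-≐-sat⇝ V (λ n → box Ri (V n)) (λ n _ → ⇔-refl) φ x)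
           (valid (λ n → box Ri (V n)) (λ n → P-box (qV n)) x))

proposition4p15 : LEM → (Θ : Lim → Set) → IsS4KLogic Θ → (𝒞 : S4KClass) → (∀ F → 𝒞 F → IsGeneralS4KFrame F) → CharacterisedS4K Θ 𝒞 → (∀ G → ρ̂Class 𝒞 G → IsGeneral⇝Frame G) × Characterised⇝ (ρ Θ) (ρ̂Class 𝒞)
proposition4p15 lem Θ _ 𝒞 general characterised = ρ̂𝒞-general , ρ̂𝒞-characterises
  where
  ρ̂𝒞-general : ∀ G → ρ̂Class 𝒞 G → IsGeneral⇝Frame G
  ρ̂𝒞-general _ (F , F∈𝒞 , refl) = ρ̂-isGeneral⇝Frame F (general F F∈𝒞) lem

  transfer : ∀ φ {F} → 𝒞 F → ValidS4K F (t φ) ⇔ Valid⇝ (ρ̂ F) φ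
  transfer φ {F} F∈𝒞 = ValidS4K-t⇔Valid⇝-ρ̂ F (general F F∈𝒞) φ

  ρ̂𝒞-characterises : Characterised⇝ (ρ Θ) (ρ̂Class 𝒞)
  ρ̂𝒞-characterises φ = mk⇔
    (λ tφ∈Θ → λ { _ (F , F∈𝒞 , refl) → to (transfer φ F∈𝒞) (to (characterised (t φ)) tφ∈Θ F F∈𝒞) })
    (λ valid → from (characterised (t φ))
                 (λ F F∈𝒞 → from (transfer φ F∈𝒞) (valid (ρ̂ F) (F , F∈𝒞 , refl))))
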